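{- Let $G=(V,E)$ be a simple connected graph and let $s\geq 1$ be an integer. Let $G_s=(V_s,E_s)$ be the $s$-th subdivision graph of $G$. Then $$4|E_s|\sum_{e_{ij}\in E_s}d_id_j-\Big[\sum_{e_{ij}\in E_s}(d_i+d_j)\Big]^2=-\Big[\sum_{e_{uv}\in E}(d_u+d_v-4)\Big]^2,$$ where on the left degrees are taken in $G_s$ and on the right in $G$.
   Context: $d_u$ denotes the degree of vertex $u$ and $e_{uv}$ the edge with endpoints $u,v$. The $s$-th subdivision graph $G_s$ of $G$ is obtained by inserting $s$ new vertices into each edge of $G$ (i.e. replacing each edge by a path with $s$ internal new vertices). -}

module Defs where

open import Data.Nat using (ℕ; zero; suc; _+_; _*_)
open import Data.Fin using (Fin; zero; suc; inject₁; fromℕ)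
open import Data.Nat.ListAction using (sum)
open import Data.List using (List; []; _∷_; _++_; map; foldr; length; zip; allFin; concatMap; [_])
open import Data.List.Membership.Propositional using (_∈_)
open import Data.List.Relation.Unary.All using (All)
open import Data.List.Relation.Unary.AllPairs using (AllPairs)
open import Data.Product using (_×_; _,_; proj₁; proj₂)
open import Data.Sum using (_⊎_; inj₁; inj₂)
open import Relation.Binary.PropositionalEquality using (_≡_; _≢_)
open import Relation.Binary.Definitions using (DecidableEquality)
open import Relation.Binary.Construct.Closure.ReflexiveTransitive using (Star)
open import Relation.Nullary using (¬_; Dec; yes; no)
open import Data.Integer as ℤ using (ℤ)
open import Data.Fin.Properties using (_≟_)
import Data.Product.Properties as ×P
import Data.Sum.Properties as ⊎P

-- An undirected graph given by its edge list; an edge e_{uv} is a pair (u , v).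
EdgeList : Set → Set
EdgeList V = List (V × V)

SameEdge : {V : Set} → V × V → V × V → Set
SameEdge (u , v) (x , y) = (u ≡ x × v ≡ y) ⊎ (u ≡ y × v ≡ x)

record SimpleGraph (n : ℕ) : Set where
  field
    edges    : EdgeList (Fin n)
    loopless : All (λ e → proj₁ e ≢ proj₂ e) edges
    noMulti  : AllPairs (λ e f → ¬ SameEdge e f) edges
open SimpleGraph public

Adj : {n : ℕ} → SimpleGraph n → Fin n → Fin n → Set
Adj G u v = ((u , v) ∈ edges G) ⊎ ((v , u) ∈ edges G)

Connected : {n : ℕ} → SimpleGraph n → Set
Connected {n} G = (u v : Fin n) → Star (Adj G) u v

[_≟ᵢ_] : {V : Set} → DecidableEquality V → V → V → ℕ
[ _≟_ ≟ᵢ x ] y with x ≟ y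
... | yes _ = 1
... | no  _ = 0

degree : {V : Set} → DecidableEquality V → EdgeList V → V → ℕ
degree _≟_ es u = sum (map (λ e → [ _≟_ ≟ᵢ proj₁ e ] u + [ _≟_ ≟ᵢ proj₂ e ] u) es)

-- Vertices of the s-th subdivision: old vertices, plus new vertices (k , t),
-- the t-th new vertex inserted into the k-th edge.
SubV : (V : Set) (m s : ℕ) → Set
SubV V m s = V ⊎ (Fin m × Fin s)

subdivPath : {V : Set} {m : ℕ} (s : ℕ) → Fin m → V → V → EdgeList (SubV V m s)
subdivPath zero k u v = [ (inj₁ u , inj₁ v) ]
subdivPath {m = m} (suc r) k u v =
  (inj₁ u , inj₂ (k , zero))
  ∷ (map (λ t → (inj₂ (k , inject₁ t) , inj₂ (k , suc t))) (allFin r)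
     ++ [ (inj₂ (k , fromℕ r) , inj₁ v) ])

subdivision : {V : Set} (es : EdgeList V) (s : ℕ) → EdgeList (SubV V (length es) s)
subdivision es s = concatMap (λ p → subdivPath s (proj₁ p) (proj₁ (proj₂ p)) (proj₂ (proj₂ p)))
                             (zip (allFin (length es)) es)

_≟ₛ_ : {n m s : ℕ} → DecidableEquality (SubV (Fin n) m s)
_≟ₛ_ = ⊎P.≡-dec _≟_ (×P.≡-dec _≟_ _≟_)

sumℤ : {A : Set} → (A → ℤ) → List A → ℤ
sumℤ f xs = foldr (λ x acc → f x ℤ.+ acc) (ℤ.+ 0) xs

-- Subdividing an edge uv of G turns it into a path u x₀ … x_r v (r = s - 1) whose new vertices
-- all have degree 2, while the old vertices keep their degrees.  Hence every sum over E_s of a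
-- function φ of the two end-degrees splits, edge by edge of G, as φ(d_u,2) + r·φ(2,2) + φ(2,d_v).
-- With m = |E| and M₁ = Σ_{uv∈E} (d_u + d_v) this gives
--   |E_s| = (r+2)m,   Σ d_i d_j = 2M₁ + 4rm,   Σ (d_i + d_j) = M₁ + 4(r+1)m,
-- and 4(r+2)m(2M₁ + 4rm) - (M₁ + 4(r+1)m)² = -(M₁ - 4m)² is a polynomial identity.
module Submission where

open import Defs
open import Data.Nat using (ℕ; _≤_)
open import Data.Integer using (ℤ; +_; _*_; _-_; -_)
open import Data.List using (length)
open import Data.Fin.Properties using (_≟_)
open import Data.Product using (proj₁; proj₂)
open import Relation.Binary.PropositionalEquality using (_≡_)

open import Data.Nat as ℕ using (zero; suc; s≤s; z≤n)
import Data.Nat.Properties as ℕₚ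
import Data.Nat.Tactic.RingSolver as ℕ-Solver
open import Data.Nat.ListAction using (sum)
open import Data.Nat.ListAction.Properties using (sum-++)
open import Data.Integer using (_+_)
open import Data.Integer.Properties using (pos-*; *-zeroʳ)
import Data.Integer.Tactic.RingSolver as ℤ-Solver
open import Data.Fin using (Fin; inject₁; fromℕ)
open import Data.Fin.Properties using (suc-injective)
open import Data.List using (List; []; _∷_; _++_; [_]; map; zip; allFin; tabulate; concatMap)
open import Data.List.Properties using (map-++; map-cong; map-∘; map-tabulate; length-tabulate)
open import Data.Product using (_×_; _,_)
import Data.Product.Properties as ×
open import Data.Sum using (inj₁; inj₂)
open import Data.Sum.Properties using (inj₁-injective; inj₂-injective)
open import Function using (_∘_; id; Injective)
open import Relation.Binary.Definitions using (DecidableEquality)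
open import Relation.Binary.PropositionalEquality
  using (refl; sym; trans; cong; cong₂; _≗_; module ≡-Reasoning)
open import Relation.Nullary using (yes; no; contradiction)
open import Algebra.Properties.Semiring.Sum ℕₚ.+-*-semiring
  using (sum-syntax; sum-cong-≗; sum-replicate-zero; sum-init-last; ∑-distrib-+; *-distribˡ-sum)
  renaming (sum to ∑)

open ≡-Reasoning

private
  variable
    A B : Set

module _ (_≟ᴬ_ : DecidableEquality A) (_≟ᴮ_ : DecidableEquality B) where

  indicator-injective : {f : A → B} → Injective _≡_ _≡_ f →
                        ∀ x y → [ _≟ᴮ_ ≟ᵢ f x ] (f y) ≡ [ _≟ᴬ_ ≟ᵢ x ] y
  indicator-injective {f} f-inj x y with x ≟ᴬ y | f x ≟ᴮ f y
  ... | yes _    | yes _     = refl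
  ... | yes refl | no fx≢fx  = contradiction refl fx≢fx
  ... | no x≢y   | yes fx≡fy = contradiction (f-inj fx≡fy) x≢y
  ... | no _     | no _      = refl

  indicator-× : ∀ a b a′ b′ →
    [ ×.≡-dec _≟ᴬ_ _≟ᴮ_ ≟ᵢ (a , b) ] (a′ , b′) ≡ [ _≟ᴬ_ ≟ᵢ a ] a′ ℕ.* [ _≟ᴮ_ ≟ᵢ b ] b′
  indicator-× a b a′ b′ with a ≟ᴬ a′ | b ≟ᴮ b′ | ×.≡-dec _≟ᴬ_ _≟ᴮ_ (a , b) (a′ , b′)
  ... | yes refl | yes refl | yes _    = refl
  ... | yes refl | yes refl | no ab≢ab = contradiction refl ab≢ab
  ... | no a≢a′  | _        | yes refl = contradiction refl a≢a′
  ... | yes _    | no b≢b′  | yes refl = contradiction refl b≢b′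
  ... | no _     | _        | no _     = refl
  ... | yes _    | no _     | no _     = refl

∑-indicator : ∀ {m} (t′ : Fin m) → ∑[ t < m ] [ _≟_ ≟ᵢ t ] t′ ≡ 1
∑-indicator {suc m} Fin.zero    = cong suc (sum-replicate-zero m)
∑-indicator {suc m} (Fin.suc j) = begin
  ∑[ t < m ] [ _≟_ ≟ᵢ Fin.suc t ] (Fin.suc j)
    ≡⟨ sum-cong-≗ (λ t → indicator-injective _≟_ _≟_ suc-injective t j) ⟩
  ∑[ t < m ] [ _≟_ ≟ᵢ t ] j
    ≡⟨ ∑-indicator j ⟩
  1 ∎

∑-const : ∀ r c → ∑[ t < r ] c ≡ r ℕ.* c
∑-const zero    c = refl
∑-const (suc r) c = cong (c ℕ.+_) (∑-const r c)

sum-map-++ : (f : A → ℕ) (xs ys : List A) →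
             sum (map f (xs ++ ys)) ≡ sum (map f xs) ℕ.+ sum (map f ys)
sum-map-++ f xs ys = trans (cong sum (map-++ f xs ys)) (sum-++ (map f xs) (map f ys))

sum-map-concatMap : (f : B → ℕ) (g : A → List B) (xs : List A) →
                    sum (map f (concatMap g xs)) ≡ sum (map (λ x → sum (map f (g x))) xs)
sum-map-concatMap f g []       = refl
sum-map-concatMap f g (x ∷ xs) = trans (sum-map-++ f (g x) (concatMap g xs))
                                       (cong (sum (map f (g x)) ℕ.+_) (sum-map-concatMap f g xs))

sum-map-cong : {f g : A → ℕ} → f ≗ g → (xs : List A) → sum (map f xs) ≡ sum (map g xs)
sum-map-cong f≗g xs = cong sum (map-cong f≗g xs)

length≡sum-map-1 : (xs : List A) → length xs ≡ sum (map (λ _ → 1) xs)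
length≡sum-map-1 []       = refl
length≡sum-map-1 (x ∷ xs) = cong suc (length≡sum-map-1 xs)

sum-map-affine : (f g : A → ℕ) (a b : ℕ) → (∀ x → g x ≡ a ℕ.* f x ℕ.+ b) → (xs : List A) →
                 sum (map g xs) ≡ a ℕ.* sum (map f xs) ℕ.+ b ℕ.* length xs
sum-map-affine f g a b g≡ []       = sym (cong₂ ℕ._+_ (ℕₚ.*-zeroʳ a) (ℕₚ.*-zeroʳ b))
sum-map-affine f g a b g≡ (x ∷ xs) = begin
  g x ℕ.+ sum (map g xs)
    ≡⟨ cong₂ ℕ._+_ (g≡ x) (sum-map-affine f g a b g≡ xs) ⟩
  a ℕ.* f x ℕ.+ b ℕ.+ (a ℕ.* sum (map f xs) ℕ.+ b ℕ.* length xs)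
    ≡⟨ regroup a b (f x) (sum (map f xs)) (length xs) ⟩
  a ℕ.* (f x ℕ.+ sum (map f xs)) ℕ.+ b ℕ.* suc (length xs) ∎
  where
  regroup : ∀ a b y S l → a ℕ.* y ℕ.+ b ℕ.+ (a ℕ.* S ℕ.+ b ℕ.* l) ≡ a ℕ.* (y ℕ.+ S) ℕ.+ b ℕ.* suc l
  regroup = ℕ-Solver.solve-∀

sum-map-allFin : ∀ {m} (f : Fin m → ℕ) → sum (map f (allFin m)) ≡ ∑[ t < m ] f t
sum-map-allFin f = trans (cong sum (map-tabulate id f)) (sum-tabulate f)
  where
  sum-tabulate : ∀ {m} (g : Fin m → ℕ) → sum (tabulate g) ≡ ∑[ t < m ] g t
  sum-tabulate {zero}  g = refl
  sum-tabulate {suc m} g = cong (g Fin.zero ℕ.+_) (sum-tabulate (g ∘ Fin.suc))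

map-proj₁-zip : (xs : List A) (ys : List B) → length xs ≡ length ys → map proj₁ (zip xs ys) ≡ xs
map-proj₁-zip []       []       _  = refl
map-proj₁-zip (x ∷ xs) (y ∷ ys) eq = cong (x ∷_) (map-proj₁-zip xs ys (ℕₚ.suc-injective eq))

map-proj₂-zip : (xs : List A) (ys : List B) → length xs ≡ length ys → map proj₂ (zip xs ys) ≡ ys
map-proj₂-zip []       []       _  = refl
map-proj₂-zip (x ∷ xs) (y ∷ ys) eq = cong (y ∷_) (map-proj₂-zip xs ys (ℕₚ.suc-injective eq))

sumℤ-pos : (f : A → ℕ) (xs : List A) → sumℤ (λ x → + f x) xs ≡ + sum (map f xs)
sumℤ-pos f []       = refl
sumℤ-pos f (x ∷ xs) = cong (_+_ (+ f x)) (sumℤ-pos f xs)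

sumℤ-sub-const : (F : A → ℤ) (c : ℤ) (xs : List A) →
                 sumℤ (λ x → F x - c) xs ≡ sumℤ F xs - c * + length xs
sumℤ-sub-const F c []       = sym (cong (_-_ (+ 0)) (*-zeroʳ c))
sumℤ-sub-const F c (x ∷ xs) = trans (cong (_+_ (F x - c)) (sumℤ-sub-const F c xs))
                                    (regroup (F x) (sumℤ F xs) c (+ length xs))
  where
  regroup : ∀ a S c l → a - c + (S - c * l) ≡ a + S - c * (+ 1 + l)
  regroup = ℤ-Solver.solve-∀

module _ {n m r : ℕ} where

  private
    V : Set
    V = SubV (Fin n) m (suc r)

  sum-map-subdivPath : (f : V × V → ℕ) (k : Fin m) (u v : Fin n) →
    sum (map f (subdivPath (suc r) k u v))
      ≡ f (inj₁ u , inj₂ (k , Fin.zero))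
        ℕ.+ (∑[ t < r ] f (inj₂ (k , inject₁ t) , inj₂ (k , Fin.suc t))
             ℕ.+ f (inj₂ (k , fromℕ r) , inj₁ v))
  sum-map-subdivPath f k u v = cong (f (inj₁ u , inj₂ (k , Fin.zero)) ℕ.+_) (begin
    sum (map f (map inner (allFin r) ++ [ last ]))
      ≡⟨ sum-map-++ f (map inner (allFin r)) [ last ] ⟩
    sum (map f (map inner (allFin r))) ℕ.+ (f last ℕ.+ 0)
      ≡⟨ cong₂ ℕ._+_ (cong sum (sym (map-∘ (allFin r)))) (ℕₚ.+-identityʳ (f last)) ⟩
    sum (map (f ∘ inner) (allFin r)) ℕ.+ f last
      ≡⟨ cong (ℕ._+ f last) (sum-map-allFin (f ∘ inner)) ⟩
    ∑[ t < r ] f (inner t) ℕ.+ f last ∎)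
    where
    inner : Fin r → V × V
    inner t = (inj₂ (k , inject₁ t) , inj₂ (k , Fin.suc t))
    last : V × V
    last = (inj₂ (k , fromℕ r) , inj₁ v)

  -- The first ends of the edges are u, x₀, …, x_r and the second ends x₀, …, x_r, v: the sum
  -- over the x_t is split off at the front in the one case and at the back in the other.
  handshake-subdivPath : (g : V → ℕ) (k : Fin m) (u v : Fin n) →
    sum (map (λ e → g (proj₁ e) ℕ.+ g (proj₂ e)) (subdivPath (suc r) k u v))
      ≡ g (inj₁ u) ℕ.+ g (inj₁ v) ℕ.+ 2 ℕ.* ∑[ t < suc r ] g (inj₂ (k , t))
  handshake-subdivPath g k u v = begin
    sum (map (λ e → g (proj₁ e) ℕ.+ g (proj₂ e)) (subdivPath (suc r) k u v))
      ≡⟨ sum-map-subdivPath _ k u v ⟩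
    gu ℕ.+ x Fin.zero ℕ.+ (∑[ t < r ] (x (inject₁ t) ℕ.+ x (Fin.suc t)) ℕ.+ (x (fromℕ r) ℕ.+ gv))
      ≡⟨ cong (λ σ → gu ℕ.+ x Fin.zero ℕ.+ (σ ℕ.+ (x (fromℕ r) ℕ.+ gv)))
              (∑-distrib-+ (x ∘ inject₁) (x ∘ Fin.suc)) ⟩
    gu ℕ.+ x Fin.zero ℕ.+ (∑ (x ∘ inject₁) ℕ.+ ∑ (x ∘ Fin.suc) ℕ.+ (x (fromℕ r) ℕ.+ gv))
      ≡⟨ regroup gu (x Fin.zero) (∑ (x ∘ inject₁)) (∑ (x ∘ Fin.suc)) (x (fromℕ r)) gv ⟩
    gu ℕ.+ gv ℕ.+ ((x Fin.zero ℕ.+ ∑ (x ∘ Fin.suc)) ℕ.+ (∑ (x ∘ inject₁) ℕ.+ x (fromℕ r)))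
      ≡⟨ cong (λ σ → gu ℕ.+ gv ℕ.+ (∑ x ℕ.+ σ)) (sym (sum-init-last x)) ⟩
    gu ℕ.+ gv ℕ.+ (∑ x ℕ.+ ∑ x)
      ≡⟨ cong (λ σ → gu ℕ.+ gv ℕ.+ (∑ x ℕ.+ σ)) (sym (ℕₚ.+-identityʳ (∑ x))) ⟩
    gu ℕ.+ gv ℕ.+ 2 ℕ.* ∑ x ∎
    where
    gu gv : ℕ
    gu = g (inj₁ u)
    gv = g (inj₁ v)
    x : Fin (suc r) → ℕ
    x t = g (inj₂ (k , t))
    regroup : ∀ a p X Y q b →
              a ℕ.+ p ℕ.+ (X ℕ.+ Y ℕ.+ (q ℕ.+ b)) ≡ a ℕ.+ b ℕ.+ ((p ℕ.+ Y) ℕ.+ (X ℕ.+ q))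
    regroup = ℕ-Solver.solve-∀

  degree-subdivPath-inj₁ : (k : Fin m) (u v w : Fin n) →
    degree _≟ₛ_ (subdivPath (suc r) k u v) (inj₁ w) ≡ [ _≟_ ≟ᵢ u ] w ℕ.+ [ _≟_ ≟ᵢ v ] w
  degree-subdivPath-inj₁ k u v w = begin
    degree _≟ₛ_ (subdivPath (suc r) k u v) (inj₁ w)
      ≡⟨ handshake-subdivPath (λ y → [ _≟ₛ_ ≟ᵢ y ] (inj₁ w)) k u v ⟩
    [ u ≟₁ w ] ℕ.+ [ v ≟₁ w ] ℕ.+ 2 ℕ.* ∑[ t < suc r ] 0
      ≡⟨ cong (λ σ → [ u ≟₁ w ] ℕ.+ [ v ≟₁ w ] ℕ.+ 2 ℕ.* σ) (sum-replicate-zero (suc r)) ⟩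
    [ u ≟₁ w ] ℕ.+ [ v ≟₁ w ] ℕ.+ 0
      ≡⟨ ℕₚ.+-identityʳ _ ⟩
    [ u ≟₁ w ] ℕ.+ [ v ≟₁ w ]
      ≡⟨ cong₂ ℕ._+_ (indicator-inj₁ u w) (indicator-inj₁ v w) ⟩
    [ _≟_ ≟ᵢ u ] w ℕ.+ [ _≟_ ≟ᵢ v ] w ∎
    where
    [_≟₁_] : Fin n → Fin n → ℕ
    [ x ≟₁ y ] = [ _≟ₛ_ ≟ᵢ inj₁ x ] (inj₁ {B = Fin m × Fin (suc r)} y)
    indicator-inj₁ : ∀ x y → [ x ≟₁ y ] ≡ [ _≟_ ≟ᵢ x ] y
    indicator-inj₁ = indicator-injective _≟_ _≟ₛ_ inj₁-injective

  degree-subdivPath-inj₂ : (k k′ : Fin m) (t′ : Fin (suc r)) (u v : Fin n) →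
    degree _≟ₛ_ (subdivPath (suc r) k u v) (inj₂ (k′ , t′)) ≡ 2 ℕ.* [ _≟_ ≟ᵢ k ] k′
  degree-subdivPath-inj₂ k k′ t′ u v = begin
    degree _≟ₛ_ (subdivPath (suc r) k u v) (inj₂ (k′ , t′))
      ≡⟨ handshake-subdivPath (λ y → [ _≟ₛ_ ≟ᵢ y ] (inj₂ (k′ , t′))) k u v ⟩
    2 ℕ.* ∑[ t < suc r ] [ _≟ₛ_ ≟ᵢ inj₂ (k , t) ] (inj₂ {A = Fin n} (k′ , t′))
      ≡⟨ cong (2 ℕ.*_) (sum-cong-≗ (λ t → indicator-inj₂ k t)) ⟩
    2 ℕ.* ∑[ t < suc r ] ([ _≟_ ≟ᵢ k ] k′ ℕ.* [ _≟_ ≟ᵢ t ] t′)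
      ≡⟨ cong (2 ℕ.*_) (*-distribˡ-sum ([ _≟_ ≟ᵢ k ] k′) (λ t → [ _≟_ ≟ᵢ t ] t′)) ⟨
    2 ℕ.* ([ _≟_ ≟ᵢ k ] k′ ℕ.* ∑[ t < suc r ] [ _≟_ ≟ᵢ t ] t′)
      ≡⟨ cong (λ σ → 2 ℕ.* ([ _≟_ ≟ᵢ k ] k′ ℕ.* σ)) (∑-indicator t′) ⟩
    2 ℕ.* ([ _≟_ ≟ᵢ k ] k′ ℕ.* 1)
      ≡⟨ cong (2 ℕ.*_) (ℕₚ.*-identityʳ ([ _≟_ ≟ᵢ k ] k′)) ⟩
    2 ℕ.* [ _≟_ ≟ᵢ k ] k′ ∎
    where
    indicator-inj₂ : ∀ k t → [ _≟ₛ_ ≟ᵢ inj₂ (k , t) ] (inj₂ {A = Fin n} (k′ , t′))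
                             ≡ [ _≟_ ≟ᵢ k ] k′ ℕ.* [ _≟_ ≟ᵢ t ] t′
    indicator-inj₂ k t =
      trans (indicator-injective (×.≡-dec _≟_ _≟_) _≟ₛ_ inj₂-injective (k , t) (k′ , t′))
            (indicator-× _≟_ _≟_ k t k′ t′)

module Subdivision {n : ℕ} (es : EdgeList (Fin n)) (r : ℕ) where

  m : ℕ
  m = length es

  Es : EdgeList (SubV (Fin n) m (suc r))
  Es = subdivision es (suc r)

  d : Fin n → ℕ
  d = degree _≟_ es

  dₛ : SubV (Fin n) m (suc r) → ℕ
  dₛ = degree _≟ₛ_ Es

  private
    indexed : List (Fin m × (Fin n × Fin n))
    indexed = zip (allFin m) es

    path : Fin m × (Fin n × Fin n) → EdgeList (SubV (Fin n) m (suc r))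
    path p = subdivPath (suc r) (proj₁ p) (proj₁ (proj₂ p)) (proj₂ (proj₂ p))

    length-allFin : length (allFin m) ≡ m
    length-allFin = length-tabulate id

    sum-indexed-proj₁ : (F : Fin m → ℕ) → sum (map (F ∘ proj₁) indexed) ≡ ∑[ k < m ] F k
    sum-indexed-proj₁ F = begin
      sum (map (F ∘ proj₁) indexed)    ≡⟨ cong sum (map-∘ indexed) ⟩
      sum (map F (map proj₁ indexed))  ≡⟨ cong (sum ∘ map F) (map-proj₁-zip (allFin m) es length-allFin) ⟩
      sum (map F (allFin m))           ≡⟨ sum-map-allFin F ⟩
      ∑[ k < m ] F k                   ∎

    sum-indexed-proj₂ : (F : Fin n × Fin n → ℕ) → sum (map (F ∘ proj₂) indexed) ≡ sum (map F es)
    sum-indexed-proj₂ F = begin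
      sum (map (F ∘ proj₂) indexed)    ≡⟨ cong sum (map-∘ indexed) ⟩
      sum (map F (map proj₂ indexed))  ≡⟨ cong (sum ∘ map F) (map-proj₂-zip (allFin m) es length-allFin) ⟩
      sum (map F es)                   ∎

  degree-subdivision-inj₁ : ∀ w → dₛ (inj₁ w) ≡ d w
  degree-subdivision-inj₁ w = begin
    dₛ (inj₁ w)
      ≡⟨ sum-map-concatMap _ path indexed ⟩
    sum (map (λ p → degree _≟ₛ_ (path p) (inj₁ w)) indexed)
      ≡⟨ sum-map-cong (λ (k , u , v) → degree-subdivPath-inj₁ k u v w) indexed ⟩
    sum (map (incidence ∘ proj₂) indexed)
      ≡⟨ sum-indexed-proj₂ incidence ⟩
    d w ∎
    where
    incidence : Fin n × Fin n → ℕ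
    incidence e = [ _≟_ ≟ᵢ proj₁ e ] w ℕ.+ [ _≟_ ≟ᵢ proj₂ e ] w

  degree-subdivision-inj₂ : ∀ k t → dₛ (inj₂ (k , t)) ≡ 2
  degree-subdivision-inj₂ k t = begin
    dₛ (inj₂ (k , t))
      ≡⟨ sum-map-concatMap _ path indexed ⟩
    sum (map (λ p → degree _≟ₛ_ (path p) (inj₂ (k , t))) indexed)
      ≡⟨ sum-map-cong (λ (k′ , u , v) → degree-subdivPath-inj₂ k′ k t u v) indexed ⟩
    sum (map ((λ k′ → 2 ℕ.* [ _≟_ ≟ᵢ k′ ] k) ∘ proj₁) indexed)
      ≡⟨ sum-indexed-proj₁ _ ⟩
    ∑[ k′ < m ] (2 ℕ.* [ _≟_ ≟ᵢ k′ ] k)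
      ≡⟨ *-distribˡ-sum 2 (λ k′ → [ _≟_ ≟ᵢ k′ ] k) ⟨
    2 ℕ.* ∑[ k′ < m ] [ _≟_ ≟ᵢ k′ ] k
      ≡⟨ cong (2 ℕ.*_) (∑-indicator k) ⟩
    2 ∎

  sum-subdivision : (φ : ℕ → ℕ → ℕ) →
    sum (map (λ e → φ (dₛ (proj₁ e)) (dₛ (proj₂ e))) Es)
      ≡ sum (map (λ e → φ (d (proj₁ e)) 2 ℕ.+ (r ℕ.* φ 2 2 ℕ.+ φ 2 (d (proj₂ e)))) es)
  sum-subdivision φ = begin
    sum (map F Es)                                  ≡⟨ sum-map-concatMap F path indexed ⟩
    sum (map (λ p → sum (map F (path p))) indexed)  ≡⟨ sum-map-cong sum-path indexed ⟩
    sum (map (G ∘ proj₂) indexed)                   ≡⟨ sum-indexed-proj₂ G ⟩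
    sum (map G es)                                  ∎
    where
    F : SubV (Fin n) m (suc r) × SubV (Fin n) m (suc r) → ℕ
    F e = φ (dₛ (proj₁ e)) (dₛ (proj₂ e))
    G : Fin n × Fin n → ℕ
    G e = φ (d (proj₁ e)) 2 ℕ.+ (r ℕ.* φ 2 2 ℕ.+ φ 2 (d (proj₂ e)))
    sum-path : ∀ p → sum (map F (path p)) ≡ G (proj₂ p)
    sum-path (k , u , v) = trans (sum-map-subdivPath F k u v)
      (cong₂ ℕ._+_ (cong₂ φ (degree-subdivision-inj₁ u) (degree-subdivision-inj₂ k Fin.zero))
                   (cong₂ ℕ._+_ ∑-inner
                                (cong₂ φ (degree-subdivision-inj₂ k (fromℕ r)) (degree-subdivision-inj₁ v))))
      where
      ∑-inner : ∑[ t < r ] F (inj₂ (k , inject₁ t) , inj₂ (k , Fin.suc t)) ≡ r ℕ.* φ 2 2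
      ∑-inner = trans (sum-cong-≗ λ t → cong₂ φ (degree-subdivision-inj₂ k (inject₁ t))
                                                (degree-subdivision-inj₂ k (Fin.suc t)))
                      (∑-const r (φ 2 2))

  edgeDegreeSum : Fin n × Fin n → ℕ
  edgeDegreeSum e = d (proj₁ e) ℕ.+ d (proj₂ e)

  M₁ : ℕ
  M₁ = sum (map edgeDegreeSum es)

  length-subdivision : length Es ≡ (2 ℕ.+ r) ℕ.* m
  length-subdivision = begin
    length Es
      ≡⟨ length≡sum-map-1 Es ⟩
    sum (map (λ _ → 1) Es)
      ≡⟨ sum-subdivision (λ _ _ → 1) ⟩
    sum (map (λ _ → 1 ℕ.+ (r ℕ.* 1 ℕ.+ 1)) es)
      ≡⟨ sum-map-affine edgeDegreeSum _ 0 (2 ℕ.+ r) (λ _ → edges-per-path r) es ⟩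
    (2 ℕ.+ r) ℕ.* m ∎
    where
    edges-per-path : ∀ r → 1 ℕ.+ (r ℕ.* 1 ℕ.+ 1) ≡ 2 ℕ.+ r
    edges-per-path = ℕ-Solver.solve-∀

  sum-products-subdivision :
    sum (map (λ e → dₛ (proj₁ e) ℕ.* dₛ (proj₂ e)) Es) ≡ 2 ℕ.* M₁ ℕ.+ 4 ℕ.* r ℕ.* m
  sum-products-subdivision = trans (sum-subdivision ℕ._*_)
    (sum-map-affine edgeDegreeSum _ 2 (4 ℕ.* r) (λ e → expand r (d (proj₁ e)) (d (proj₂ e))) es)
    where
    expand : ∀ r a b → a ℕ.* 2 ℕ.+ (r ℕ.* (2 ℕ.* 2) ℕ.+ 2 ℕ.* b) ≡ 2 ℕ.* (a ℕ.+ b) ℕ.+ 4 ℕ.* r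
    expand = ℕ-Solver.solve-∀

  sum-sums-subdivision :
    sum (map (λ e → dₛ (proj₁ e) ℕ.+ dₛ (proj₂ e)) Es) ≡ M₁ ℕ.+ (4 ℕ.+ 4 ℕ.* r) ℕ.* m
  sum-sums-subdivision = trans (sum-subdivision ℕ._+_)
    (trans (sum-map-affine edgeDegreeSum _ 1 (4 ℕ.+ 4 ℕ.* r)
                           (λ e → expand r (d (proj₁ e)) (d (proj₂ e))) es)
           (cong (ℕ._+ (4 ℕ.+ 4 ℕ.* r) ℕ.* m) (ℕₚ.*-identityˡ M₁)))
    where
    expand : ∀ r a b → a ℕ.+ 2 ℕ.+ (r ℕ.* (2 ℕ.+ 2) ℕ.+ (2 ℕ.+ b)) ≡ 1 ℕ.* (a ℕ.+ b) ℕ.+ (4 ℕ.+ 4 ℕ.* r)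
    expand = ℕ-Solver.solve-∀

  length-subdivisionℤ : + length Es ≡ (+ 2 + + r) * + m
  length-subdivisionℤ = trans (cong +_ length-subdivision) (pos-* (2 ℕ.+ r) m)

  sumℤ-products-subdivision :
    sumℤ (λ e → + (dₛ (proj₁ e) ℕ.* dₛ (proj₂ e))) Es ≡ + 2 * + M₁ + + 4 * + r * + m
  sumℤ-products-subdivision = begin
    sumℤ (λ e → + (dₛ (proj₁ e) ℕ.* dₛ (proj₂ e))) Es
      ≡⟨ sumℤ-pos _ Es ⟩
    + sum (map (λ e → dₛ (proj₁ e) ℕ.* dₛ (proj₂ e)) Es)
      ≡⟨ cong +_ sum-products-subdivision ⟩
    + (2 ℕ.* M₁ ℕ.+ 4 ℕ.* r ℕ.* m)
      ≡⟨ cong₂ _+_ (pos-* 2 M₁) (trans (pos-* (4 ℕ.* r) m) (cong (_* + m) (pos-* 4 r))) ⟩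
    + 2 * + M₁ + + 4 * + r * + m ∎

  sumℤ-sums-subdivision :
    sumℤ (λ e → + (dₛ (proj₁ e) ℕ.+ dₛ (proj₂ e))) Es ≡ + M₁ + (+ 4 + + 4 * + r) * + m
  sumℤ-sums-subdivision = begin
    sumℤ (λ e → + (dₛ (proj₁ e) ℕ.+ dₛ (proj₂ e))) Es
      ≡⟨ sumℤ-pos _ Es ⟩
    + sum (map (λ e → dₛ (proj₁ e) ℕ.+ dₛ (proj₂ e)) Es)
      ≡⟨ cong +_ sum-sums-subdivision ⟩
    + (M₁ ℕ.+ (4 ℕ.+ 4 ℕ.* r) ℕ.* m)
      ≡⟨ cong (_+_ (+ M₁)) (trans (pos-* (4 ℕ.+ 4 ℕ.* r) m) (cong (λ x → (+ 4 + x) * + m) (pos-* 4 r))) ⟩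
    + M₁ + (+ 4 + + 4 * + r) * + m ∎

  sumℤ-excess : sumℤ (λ e → + edgeDegreeSum e - + 4) es ≡ + M₁ - + 4 * + m
  sumℤ-excess = trans (sumℤ-sub-const (+_ ∘ edgeDegreeSum) (+ 4) es)
                      (cong (_- + 4 * + m) (sumℤ-pos edgeDegreeSum es))

subdivision-gap : ∀ (M m r : ℤ) {L P Q E : ℤ} →
  L ≡ (+ 2 + r) * m → P ≡ + 2 * M + + 4 * r * m → Q ≡ M + (+ 4 + + 4 * r) * m → E ≡ M - + 4 * m →
  + 4 * L * P - Q * Q ≡ - (E * E)
subdivision-gap M m r refl refl refl refl = identity M m r
  where
  identity : ∀ M m r →
    + 4 * ((+ 2 + r) * m) * (+ 2 * M + + 4 * r * m)
      - (M + (+ 4 + + 4 * r) * m) * (M + (+ 4 + + 4 * r) * m)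
    ≡ - ((M - + 4 * m) * (M - + 4 * m))
  identity = ℤ-Solver.solve-∀

lemma3 : {n : ℕ} (G : SimpleGraph n) → Connected G → (s : ℕ) → 1 ≤ s →
    let Es = subdivision (edges G) s
        ds = degree _≟ₛ_ Es
        d = degree _≟_ (edges G)
    in (+ 4) * (+ length Es) * sumℤ (λ e → + (ds (proj₁ e) Data.Nat.* ds (proj₂ e))) Es
       - sumℤ (λ e → + (ds (proj₁ e) Data.Nat.+ ds (proj₂ e))) Es
         * sumℤ (λ e → + (ds (proj₁ e) Data.Nat.+ ds (proj₂ e))) Es
       ≡ - (sumℤ (λ e → + (d (proj₁ e) Data.Nat.+ d (proj₂ e)) - + 4) (edges G)
            * sumℤ (λ e → + (d (proj₁ e) Data.Nat.+ d (proj₂ e)) - + 4) (edges G))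
lemma3 G _ (suc r) (s≤s z≤n) =
  subdivision-gap (+ M₁) (+ m) (+ r)
    length-subdivisionℤ sumℤ-products-subdivision sumℤ-sums-subdivision sumℤ-excess
  where open Subdivision (edges G) r
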